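{- Let $\ell, m, r$ be positive integers such that $2\nmid \ell$, $3\nmid \ell m$, $\ell>r$ and $3\mid r$. If $2\mid m$, then the equation $(r\ell m^2-1)^x+((\ell-r)\ell m^2+1)^y=(\ell m)^z$ has no solutions $(x,y,z)$ in positive integers other than $(x,y,z)=(1,1,2)$. -}

module Submission where

-- Put A = r l m² and B = (l - r) l m², so that A + B = (lm)². Since A - 1, B + 1 ≥ 2, size alone
-- rules out z = 1 and forces x = y = 1 when z = 2. For z ≥ 3 the parities of x and y decide:
-- if x is even, (A - 1)ˣ + (B + 1)ʸ ≡ 2 (mod m²) while m² ∣ (lm)ᶻ, impossible as 4 ∣ m²; if x is odd
-- and y even, A - 1 ≡ B + 1 ≡ -1 (mod 3) gives 3 ∣ lm; if both are odd, the binomial theorem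
-- modulo A² and B² gives xA + yB ≡ 0 (mod 2m²), i.e. l(xr + y(l - r)) ≡ l² ≡ 0 (mod 2),
-- contradicting 2 ∤ l.

module _ where
  open import Data.Nat as ℕ using (ℕ; zero; suc)
  open import Data.Integer hiding (suc)
  open import Data.Integer.Properties using (^-*-assoc; ^-zeroˡ; +-inverseʳ; pos-*)
  open import Data.Integer.Divisibility.Signed
  open import Data.Integer.Tactic.RingSolver using (solve-∀)
  open import Relation.Binary.PropositionalEquality
  open ≡-Reasoning

  infix 4 _≡_mod_

  record _≡_mod_ (a b n : ℤ) : Set where
    constructor ≡-mod
    field ∣-difference : n ∣ a - b

  module _ {n : ℤ} where

    mod-reflexive : ∀ {a b} → a ≡ b → a ≡ b mod n
    mod-reflexive {a} refl = ≡-mod (divides 0ℤ (+-inverseʳ a))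

    mod-sym : ∀ {a b} → a ≡ b mod n → b ≡ a mod n
    mod-sym {a} {b} (≡-mod n∣a-b) = ≡-mod (subst (n ∣_) (negate a b) (∣m⇒∣-m n∣a-b))
      where
      negate : ∀ a b → - (a - b) ≡ b - a
      negate = solve-∀

    mod-trans : ∀ {a b c} → a ≡ b mod n → b ≡ c mod n → a ≡ c mod n
    mod-trans {a} {b} {c} (≡-mod n∣a-b) (≡-mod n∣b-c) =
      ≡-mod (subst (n ∣_) (telescope a b c) (∣m∣n⇒∣m+n n∣a-b n∣b-c))
      where
      telescope : ∀ a b c → (a - b) + (b - c) ≡ a - c
      telescope = solve-∀

    +-mod : ∀ {a b c d} → a ≡ b mod n → c ≡ d mod n → a + c ≡ b + d mod n
    +-mod {a} {b} {c} {d} (≡-mod n∣a-b) (≡-mod n∣c-d) =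
      ≡-mod (subst (n ∣_) (regroup a b c d) (∣m∣n⇒∣m+n n∣a-b n∣c-d))
      where
      regroup : ∀ a b c d → (a - b) + (c - d) ≡ (a + c) - (b + d)
      regroup = solve-∀

    ^-mod : ∀ {a b} k → a ≡ b mod n → a ^ k ≡ b ^ k mod n
    ^-mod zero _ = mod-reflexive {1ℤ} refl
    ^-mod {a} {b} (suc k) a≡b@(≡-mod n∣a-b) with ^-mod k a≡b
    ... | ≡-mod n∣aᵏ-bᵏ = ≡-mod (subst (n ∣_) (factor a b (a ^ k) (b ^ k))
      (∣m∣n⇒∣m+n (∣n⇒∣m*n a n∣aᵏ-bᵏ) (∣n⇒∣m*n (b ^ k) n∣a-b)))
      where
      factor : ∀ a b p q → a * (p - q) + q * (a - b) ≡ a * p - b * q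
      factor = solve-∀

    ∣-mod : ∀ {a b} → a ≡ b mod n → n ∣ a → n ∣ b
    ∣-mod {a} {b} (≡-mod n∣a-b) n∣a = subst (n ∣_) (cancel a b) (∣m∣n⇒∣m-n n∣a n∣a-b)
      where
      cancel : ∀ a b → a - (a - b) ≡ b
      cancel = solve-∀

    ≡0-mod⇒∣ : ∀ {a} → a ≡ 0ℤ mod n → n ∣ a
    ≡0-mod⇒∣ a≡0 = ∣-mod (mod-sym a≡0) (divides 0ℤ refl)

    +-multiple-mod : ∀ {d} c → n ∣ d → d + c ≡ c mod n
    +-multiple-mod {d} c n∣d = ≡-mod (subst (n ∣_) (cancel d c) n∣d)
      where
      cancel : ∀ d c → d ≡ (d + c) - c
      cancel = solve-∀

  mod-weaken : ∀ {m n a b} → m ∣ n → a ≡ b mod n → a ≡ b mod m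
  mod-weaken m∣n (≡-mod n∣a-b) = ≡-mod (∣-trans m∣n n∣a-b)

  ^-linear-mod : ∀ d c k → (d + c) ^ suc k ≡ c ^ k * (c + + suc k * d) mod d * d
  ^-linear-mod d c zero = mod-reflexive (base d c)
    where
    base : ∀ d c → (d + c) * 1ℤ ≡ 1ℤ * (c + 1ℤ * d)
    base = solve-∀
  ^-linear-mod d c (suc k) with ^-linear-mod d c k
  ... | ≡-mod d²∣eₖ = ≡-mod (subst (d * d ∣_) (step d c (+ suc k) (c ^ k) ((d + c) ^ suc k))
    (∣m∣n⇒∣m+n (∣n⇒∣m*n (d + c) d²∣eₖ) (∣m⇒∣m*n (+ suc k * c ^ k) ∣-refl)))
    where
    step : ∀ d c K p q → (d + c) * (q - p * (c + K * d)) + d * d * (K * p)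
                       ≡ (d + c) * q - c * p * (c + (1ℤ + K) * d)
    step = solve-∀

  -1^even : ∀ k → -1ℤ ^ (2 ℕ.* k) ≡ 1ℤ
  -1^even k = trans (sym (^-*-assoc -1ℤ 2 k)) (^-zeroˡ k)

  module _ {n : ℤ} (α β : ℤ) where

    [α-1]^even+[β+1]^y≡2 : ∀ {x} k y → x ≡ 2 ℕ.* k → n ∣ α → n ∣ β →
                            (α - 1ℤ) ^ x + (β + 1ℤ) ^ y ≡ + 2 mod n
    [α-1]^even+[β+1]^y≡2 k y refl n∣α n∣β = mod-trans
      (+-mod (^-mod (2 ℕ.* k) (+-multiple-mod -1ℤ n∣α)) (^-mod y (+-multiple-mod 1ℤ n∣β)))
      (mod-reflexive (cong₂ _+_ (-1^even k) (^-zeroˡ y)))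

    [α-1]^odd+[β+1]^even≡0 : ∀ {x y} i j → x ≡ suc (2 ℕ.* i) → y ≡ 2 ℕ.* j →
                              n ∣ α → n ∣ β + + 2 →
                              (α - 1ℤ) ^ x + (β + 1ℤ) ^ y ≡ 0ℤ mod n
    [α-1]^odd+[β+1]^even≡0 i j refl refl n∣α n∣β+2 = mod-trans
      (+-mod (^-mod (suc (2 ℕ.* i)) (+-multiple-mod -1ℤ n∣α)) (^-mod (2 ℕ.* j) β+1≡-1))
      (mod-reflexive (cong₂ (λ u v → -1ℤ * u + v) (-1^even i) (-1^even j)))
      where
      shift : ∀ β → β + 1ℤ ≡ (β + + 2) + -1ℤ
      shift = solve-∀
      β+1≡-1 : β + 1ℤ ≡ -1ℤ mod n
      β+1≡-1 = mod-trans (mod-reflexive (shift β)) (+-multiple-mod -1ℤ n∣β+2)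

    [α-1]^odd+[β+1]^odd≡xα+yβ : ∀ {x y} i j → x ≡ suc (2 ℕ.* i) → y ≡ suc (2 ℕ.* j) →
                                n ∣ α * α → n ∣ β * β →
                                (α - 1ℤ) ^ x + (β + 1ℤ) ^ y ≡ + x * α + + y * β mod n
    [α-1]^odd+[β+1]^odd≡xα+yβ {x} {y} i j refl refl n∣α² n∣β² = mod-trans
      (+-mod (mod-weaken n∣α² (^-linear-mod α -1ℤ (2 ℕ.* i)))
             (mod-weaken n∣β² (^-linear-mod β 1ℤ (2 ℕ.* j))))
      (mod-reflexive (trans
        (cong₂ (λ u v → u * (-1ℤ + + x * α) + v * (1ℤ + + y * β)) (-1^even i) (^-zeroˡ (2 ℕ.* j)))
        (cancel (+ x) (+ y) α β)))
      where
      cancel : ∀ X Y α β → 1ℤ * (-1ℤ + X * α) + 1ℤ * (1ℤ + Y * β) ≡ X * α + Y * β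
      cancel = solve-∀

  pos-^ : ∀ m n → + (m ℕ.^ n) ≡ (+ m) ^ n
  pos-^ m zero = refl
  pos-^ m (suc n) = trans (pos-* m (m ℕ.^ n)) (cong (+ m *_) (pos-^ m n))

  pos-equation : ∀ {A B C x y} → 0 ℕ.< A → (A ℕ.∸ 1) ℕ.^ x ℕ.+ (B ℕ.+ 1) ℕ.^ y ≡ C →
                 (+ A - 1ℤ) ^ x + (+ B + 1ℤ) ^ y ≡ + C
  pos-equation {suc A} {B} {C} {x} {y} _ eq = begin
    (+ suc A - 1ℤ) ^ x + (+ B + 1ℤ) ^ y  ≡⟨ cong₂ _+_ (pos-^ A x) (pos-^ (B ℕ.+ 1) y) ⟨
    + (A ℕ.^ x ℕ.+ (B ℕ.+ 1) ℕ.^ y)      ≡⟨ cong +_ eq ⟩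
    + C                                  ∎

open import Data.Nat
  using (ℕ; zero; suc; _+_; _*_; _∸_; _^_; _≤_; _<_; _>_; z≤n; s≤s; NonZero; >-nonZero; >-nonZero⁻¹)
open import Data.Nat.Properties
open import Data.Nat.Divisibility
  using ( _∣_; _∤_; divides; ∣-trans; ∣⇒≤; ∣1⇒≡1; 1∣_; n∣m*n; m∣m*n; ∣m⇒∣m*n; ∣n⇒∣m*n; ∣m+n∣m⇒∣n
        ; *-pres-∣; *-cancelˡ-∣)
open import Data.Nat.DivMod using (_/_; _%_; m≡m%n+[m/n]*n; m%n<n)
open import Data.Nat.Primality using (Prime; euclidsLemma; prime?; prime[2]; ¬prime[1])
open import Data.Nat.Tactic.RingSolver using (solve-∀)
import Data.Integer as ℤ
open import Data.Integer.Properties using (pos-*)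
open import Data.Integer.Divisibility.Signed using (∣ᵤ⇒∣; ∣⇒∣ᵤ) renaming (_∣_ to _∣ℤ_)
open import Data.Product using (_×_; _,_)
open import Data.Sum using (inj₁; inj₂)
open import Data.Empty using (⊥; ⊥-elim)
open import Relation.Nullary using (contradiction)
open import Relation.Nullary.Decidable using (from-yes)
open import Relation.Binary.PropositionalEquality using (_≡_; refl; sym; trans; cong; cong₂; subst; subst₂)

data EvenOrOdd (n : ℕ) : Set where
  even : ∀ k → n ≡ 2 * k → EvenOrOdd n
  odd  : ∀ k → n ≡ suc (2 * k) → EvenOrOdd n

even-or-odd : ∀ n → EvenOrOdd n
even-or-odd zero = even 0 refl
even-or-odd (suc n) with even-or-odd n
... | even k refl = odd k refl
... | odd k refl = even (suc k) (cong suc (sym (+-suc k (k + 0))))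

prime[3] : Prime 3
prime[3] = from-yes (prime? 3)

prime∣m^n⇒∣m : ∀ {p} m n → Prime p → p ∣ m ^ n → p ∣ m
prime∣m^n⇒∣m m zero p-prime p∣1 with ∣1⇒≡1 p∣1
... | refl = contradiction p-prime ¬prime[1]
prime∣m^n⇒∣m m (suc n) p-prime p∣m*mⁿ with euclidsLemma m (m ^ n) p-prime p∣m*mⁿ
... | inj₁ p∣m = p∣m
... | inj₂ p∣mⁿ = prime∣m^n⇒∣m m n p-prime p∣mⁿ

3∤n⇒3∣n²+2 : ∀ n → 3 ∤ n → 3 ∣ n ^ 2 + 2
3∤n⇒3∣n²+2 n 3∤n with n / 3 | n % 3 | m%n<n n 3 | m≡m%n+[m/n]*n n 3
... | q | 0 | _ | refl = contradiction (divides q refl) 3∤n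
... | q | 1 | _ | refl = divides (3 * q * q + 2 * q + 1) (residue-1 q)
  where
  residue-1 : ∀ q → (1 + q * 3) * ((1 + q * 3) * 1) + 2 ≡ (3 * q * q + 2 * q + 1) * 3
  residue-1 = solve-∀
... | q | 2 | _ | refl = divides (3 * q * q + 4 * q + 2) (residue-2 q)
  where
  residue-2 : ∀ q → (2 + q * 3) * ((2 + q * 3) * 1) + 2 ≡ (3 * q * q + 4 * q + 2) * 3
  residue-2 = solve-∀
... | _ | suc (suc (suc _)) | s≤s (s≤s (s≤s ())) | _

m≤m^n : ∀ {m n} → 0 < m → 0 < n → m ≤ m ^ n
m≤m^n {m} {n} 0<m 0<n = subst (_≤ m ^ n) (^-identityʳ m) (^-monoʳ-≤ m {{>-nonZero 0<m}} 0<n)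

m<m^n : ∀ {m n} → 1 < m → 1 < n → m < m ^ n
m<m^n {m} {n} 1<m 1<n = subst (_< m ^ n) (^-identityʳ m) (^-monoʳ-< m 1<m 1<n)

m+n≤m^x+n^y : ∀ {m n x y} → 0 < m → 0 < n → 0 < x → 0 < y → m + n ≤ m ^ x + n ^ y
m+n≤m^x+n^y 0<m 0<n 0<x 0<y = +-mono-≤ (m≤m^n 0<m 0<x) (m≤m^n 0<n 0<y)

m^x+n^y≡m+n⇒x≡1∧y≡1 : ∀ {m n x y} → 1 < m → 1 < n → 0 < x → 0 < y →
                       m ^ x + n ^ y ≡ m + n → x ≡ 1 × y ≡ 1
m^x+n^y≡m+n⇒x≡1∧y≡1 {x = 1} {1} _ _ _ _ _ = refl , refl
m^x+n^y≡m+n⇒x≡1∧y≡1 {x = x@(suc (suc _))} {y} 1<m 1<n _ 0<y eq =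
  contradiction eq (>⇒≢
    (+-mono-<-≤ (m<m^n {n = x} 1<m (s≤s (s≤s z≤n))) (m≤m^n {n = y} (<⇒≤ 1<n) 0<y)))
m^x+n^y≡m+n⇒x≡1∧y≡1 {x = 1} {y@(suc (suc _))} 1<m 1<n 0<x _ eq =
  contradiction eq (>⇒≢
    (+-mono-≤-< (m≤m^n {n = 1} (<⇒≤ 1<m) 0<x) (m<m^n {n = y} 1<n (s≤s (s≤s z≤n)))))

m≤m*n*o^2 : ∀ m n o .{{_ : NonZero n}} .{{_ : NonZero o}} → m ≤ m * n * o ^ 2
m≤m*n*o^2 m n o = ≤-trans (m≤m*n m n) (m≤m*n (m * n) (o ^ 2) {{m^n≢0 o 2}})

[m∸1]+[n+1]≡m+n : ∀ {m} n → 0 < m → (m ∸ 1) + (n + 1) ≡ m + n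
[m∸1]+[n+1]≡m+n {suc m} n _ = trans (cong (m +_) (+-comm n 1)) (+-suc m n)

r*l*m²+s*l*m²≡[l*m]² : ∀ r s {l} m → r + s ≡ l → r * l * m ^ 2 + s * l * m ^ 2 ≡ (l * m) ^ 2
r*l*m²+s*l*m²≡[l*m]² r s m refl = factor r s m
  where
  factor : ∀ r s m → r * (r + s) * (m * (m * 1)) + s * (r + s) * (m * (m * 1))
                   ≡ (r + s) * m * ((r + s) * m * 1)
  factor = solve-∀

n²∣[m*n]^[2+k] : ∀ m n k → n ^ 2 ∣ (m * n) ^ (2 + k)
n²∣[m*n]^[2+k] m n k = *-pres-∣ (n∣m*n m) (*-pres-∣ (n∣m*n m) (1∣ ((m * n) ^ k)))

d∣n⇒d*n∣[m*n]*[m*n] : ∀ {d n} m → d ∣ n → d * n ∣ (m * n) * (m * n)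
d∣n⇒d*n∣[m*n]*[m*n] m d∣n = *-pres-∣ (∣n⇒∣m*n m d∣n) (n∣m*n m)

2∣m⇒m²∤2 : ∀ {m} → 2 ∣ m → m ^ 2 ∤ 2
2∣m⇒m²∤2 2∣m m²∣2 with ∣⇒≤ (∣-trans (*-pres-∣ 2∣m (∣m⇒∣m*n 1 2∣m)) m²∣2)
... | s≤s (s≤s ())

2*m²∣odd*A+odd*B⇒2∣l : ∀ {r s l m x y} i j .{{_ : NonZero m}} → x ≡ suc (2 * i) → y ≡ suc (2 * j) →
  r + s ≡ l → 2 * m ^ 2 ∣ x * (r * l * m ^ 2) + y * (s * l * m ^ 2) → 2 ∣ l
2*m²∣odd*A+odd*B⇒2∣l {r} {s} {_} {m} i j refl refl refl 2m²∣xA+yB =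
  prime∣m^n⇒∣m (r + s) 2 prime[2] (∣m+n∣m⇒∣n 2∣2K+l² (m∣m*n K))
  where
  K : ℕ
  K = (r + s) * (i * r + j * s)
  regroup : ∀ i j r s m →
    suc (2 * i) * (r * (r + s) * (m * (m * 1))) + suc (2 * j) * (s * (r + s) * (m * (m * 1)))
    ≡ m * (m * 1) * (2 * ((r + s) * (i * r + j * s)) + (r + s) * ((r + s) * 1))
  regroup = solve-∀
  2∣2K+l² : 2 ∣ 2 * K + (r + s) ^ 2
  2∣2K+l² = *-cancelˡ-∣ (m ^ 2) {{m^n≢0 m 2}}
    (subst₂ _∣_ (*-comm 2 (m ^ 2)) (regroup i j r s m) 2m²∣xA+yB)

no-solution-for-z≥3 : ∀ {l m r s x y z} .{{_ : NonZero l}} .{{_ : NonZero m}} .{{_ : NonZero r}} →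
  r + s ≡ l → 2 ∤ l → 3 ∤ l * m → 3 ∣ r → 2 ∣ m →
  (r * l * m ^ 2 ∸ 1) ^ x + (s * l * m ^ 2 + 1) ^ y ≡ (l * m) ^ (3 + z) → ⊥
no-solution-for-z≥3 {l} {m} {r} {s} {x} {y} {z} r+s≡l 2∤l 3∤lm 3∣r 2∣m eq =
  by-parity (even-or-odd x) (even-or-odd y)
  where
  A B : ℕ
  A = r * l * m ^ 2
  B = s * l * m ^ 2

  0<A : 0 < A
  0<A = ≤-trans (>-nonZero⁻¹ r) (m≤m*n*o^2 r l m)

  3∣A : 3 ∣ A
  3∣A = ∣m⇒∣m*n (m ^ 2) (∣m⇒∣m*n l 3∣r)

  -- B + 1 ≡ -1 (mod 3), since B = (lm)² - A with 3 ∣ A, and (lm)² ≡ 1 as 3 ∤ lm.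
  3∣B+2 : 3 ∣ B + 2
  3∣B+2 = ∣m+n∣m⇒∣n (subst (3 ∣_) [lm]²+2≡A+[B+2] (3∤n⇒3∣n²+2 (l * m) 3∤lm)) 3∣A
    where
    [lm]²+2≡A+[B+2] : (l * m) ^ 2 + 2 ≡ A + (B + 2)
    [lm]²+2≡A+[B+2] = trans (cong (_+ 2) (sym (r*l*m²+s*l*m²≡[l*m]² r s m r+s≡l))) (+-assoc A B 2)

  2∣m² : 2 ∣ m ^ 2
  2∣m² = ∣m⇒∣m*n (m ^ 1) 2∣m

  eqℤ : (ℤ.+ A ℤ.- ℤ.1ℤ) ℤ.^ x ℤ.+ (ℤ.+ B ℤ.+ ℤ.1ℤ) ℤ.^ y ≡ ℤ.+ ((l * m) ^ (3 + z))
  eqℤ = pos-equation {B = B} {x = x} {y = y} 0<A eq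

  m²∣2 : ∀ k → x ≡ 2 * k → ℤ.+ (m ^ 2) ∣ℤ ℤ.+ 2
  m²∣2 k x≡2k = ∣-mod
    (mod-trans (mod-reflexive (sym eqℤ))
      ([α-1]^even+[β+1]^y≡2 (ℤ.+ A) (ℤ.+ B) k y x≡2k
        (∣ᵤ⇒∣ (n∣m*n (r * l))) (∣ᵤ⇒∣ (n∣m*n (s * l)))))
    (∣ᵤ⇒∣ (n²∣[m*n]^[2+k] l m (suc z)))

  3∣[lm]^[3+z] : ∀ i j → x ≡ suc (2 * i) → y ≡ 2 * j → ℤ.+ 3 ∣ℤ ℤ.+ ((l * m) ^ (3 + z))
  3∣[lm]^[3+z] i j x≡2i+1 y≡2j = ≡0-mod⇒∣
    (mod-trans (mod-reflexive (sym eqℤ))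
      ([α-1]^odd+[β+1]^even≡0 (ℤ.+ A) (ℤ.+ B) i j x≡2i+1 y≡2j (∣ᵤ⇒∣ 3∣A) (∣ᵤ⇒∣ 3∣B+2)))

  2m²∣xA+yB : ∀ i j → x ≡ suc (2 * i) → y ≡ suc (2 * j) →
              ℤ.+ (2 * m ^ 2) ∣ℤ ℤ.+ (x * A + y * B)
  2m²∣xA+yB i j x≡2i+1 y≡2j+1 = subst (_ ∣ℤ_) (sym (cong₂ ℤ._+_ (pos-* x A) (pos-* y B))) (∣-mod
    (mod-trans (mod-reflexive (sym eqℤ))
      ([α-1]^odd+[β+1]^odd≡xα+yβ (ℤ.+ A) (ℤ.+ B) i j x≡2i+1 y≡2j+1
        (2m²∣[km²]² (r * l)) (2m²∣[km²]² (s * l))))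
    (∣ᵤ⇒∣ (*-pres-∣ (∣n⇒∣m*n l 2∣m) (n²∣[m*n]^[2+k] l m z))))
    where
    2m²∣[km²]² : ∀ k → ℤ.+ (2 * m ^ 2) ∣ℤ ℤ.+ (k * m ^ 2) ℤ.* ℤ.+ (k * m ^ 2)
    2m²∣[km²]² k = subst (_ ∣ℤ_) (pos-* (k * m ^ 2) (k * m ^ 2)) (∣ᵤ⇒∣ (d∣n⇒d*n∣[m*n]*[m*n] k 2∣m²))

  by-parity : EvenOrOdd x → EvenOrOdd y → ⊥
  by-parity (even k x≡2k) _ = 2∣m⇒m²∤2 2∣m (∣⇒∣ᵤ (m²∣2 k x≡2k))
  by-parity (odd i x≡2i+1) (even j y≡2j) =
    3∤lm (prime∣m^n⇒∣m (l * m) (3 + z) prime[3] (∣⇒∣ᵤ (3∣[lm]^[3+z] i j x≡2i+1 y≡2j)))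
  by-parity (odd i x≡2i+1) (odd j y≡2j+1) =
    2∤l (2*m²∣odd*A+odd*B⇒2∣l {r} {s} i j x≡2i+1 y≡2j+1 r+s≡l
           (∣⇒∣ᵤ (2m²∣xA+yB i j x≡2i+1 y≡2j+1)))

lemma3p2 : (l m r : ℕ) → 0 < l → 0 < m → 0 < r →
    2 ∤ l → 3 ∤ l * m → l > r → 3 ∣ r → 2 ∣ m →
    (x y z : ℕ) → 0 < x → 0 < y → 0 < z →
    (r * l * m ^ 2 ∸ 1) ^ x + ((l ∸ r) * l * m ^ 2 + 1) ^ y ≡ (l * m) ^ z →
    x ≡ 1 × y ≡ 1 × z ≡ 2
lemma3p2 l m r 0<l 0<m 0<r 2∤l 3∤lm r<l 3∣r 2∣m x y z 0<x 0<y 0<z = by-exponent z 0<z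
  where
  instance
    _ : NonZero l
    _ = >-nonZero 0<l
    _ : NonZero m
    _ = >-nonZero 0<m
    _ : NonZero r
    _ = >-nonZero 0<r
    _ : NonZero (l ∸ r)
    _ = >-nonZero (m<n⇒0<n∸m r<l)

  r+[l∸r]≡l : r + (l ∸ r) ≡ l
  r+[l∸r]≡l = m+[n∸m]≡n (<⇒≤ r<l)

  A B c : ℕ
  A = r * l * m ^ 2
  B = (l ∸ r) * l * m ^ 2
  c = l * m

  0<A : 0 < A
  0<A = ≤-trans 0<r (m≤m*n*o^2 r l m)

  1<A∸1 : 1 < A ∸ 1
  1<A∸1 = ∸-monoˡ-≤ 1 (≤-trans (∣⇒≤ 3∣r) (m≤m*n*o^2 r l m))

  1<B+1 : 1 < B + 1
  1<B+1 = +-monoˡ-≤ 1 (≤-trans (m<n⇒0<n∸m r<l) (m≤m*n*o^2 (l ∸ r) l m))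

  1<c : 1 < c
  1<c = ≤-trans (∣⇒≤ 2∣m) (m≤n*m m l)

  a+b≡c² : (A ∸ 1) + (B + 1) ≡ c ^ 2
  a+b≡c² = trans ([m∸1]+[n+1]≡m+n B 0<A) (r*l*m²+s*l*m²≡[l*m]² r (l ∸ r) m r+[l∸r]≡l)

  by-exponent : ∀ z → 0 < z → (A ∸ 1) ^ x + (B + 1) ^ y ≡ c ^ z → x ≡ 1 × y ≡ 1 × z ≡ 2
  by-exponent 1 _ eq = contradiction eq (>⇒≢ (begin-strict
    c ^ 1                     <⟨ ^-monoʳ-< c 1<c (n<1+n 1) ⟩
    c ^ 2                     ≡⟨ a+b≡c² ⟨
    (A ∸ 1) + (B + 1)         ≤⟨ m+n≤m^x+n^y (<⇒≤ 1<A∸1) (<⇒≤ 1<B+1) 0<x 0<y ⟩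
    (A ∸ 1) ^ x + (B + 1) ^ y ∎))
    where open ≤-Reasoning
  by-exponent 2 _ eq with m^x+n^y≡m+n⇒x≡1∧y≡1 1<A∸1 1<B+1 0<x 0<y (trans eq (sym a+b≡c²))
  ... | x≡1 , y≡1 = x≡1 , y≡1 , refl
  by-exponent (suc (suc (suc z))) _ eq =
    ⊥-elim (no-solution-for-z≥3 {x = x} {y = y} {z = z} r+[l∸r]≡l 2∤l 3∤lm 3∣r 2∣m eq)
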